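{- Let $p=2$ and let $n$ be a positive integer such that $2^n-1$ is prime. Let $\alpha,\beta$ be integers such that $\omega^{ -\alpha}$ and $\omega^{ -\beta}$ are regular characters of $\mathbb{F}_{2^n}^\times$. If $S(\omega^{ -(\alpha+\hat k)})=S(\omega^{ -(\beta+\hat k)})$ for all $0\le k<p-1$ (i.e. $S(\omega^{ -\alpha})=S(\omega^{ -\beta})$), then $\alpha\equiv 2^j\beta\pmod{2^n-1}$ for some integer $j$.
   Context: Let $\psi$ be the nontrivial additive character of $\mathbb{F}_2$. Let $\mathfrak{p}$ be a prime of $\mathbb{Q}(\mu_{2^n-1})$ above $2$; the Teichmüller character $\omega:\mathbb{F}_{2^n}^\times\to\mu_{2^n-1}$ is defined by $\omega(u)\equiv u\bmod\mathfrak{p}$. For a character $\chi$ of $\mathbb{F}_{2^n}^\times$, $S(\chi)=\sum_{x\in\mathbb{F}_{2^n}^\times}\chi(x)\psi(\mathrm{Tr}_{\mathbb{F}_{2^n}/\mathbb{F}_2}(x))$; $\hat k=k\frac{p^n-1}{p-1}$. A character of $\mathbb{F}_{2^n}^\times$ is regular if it does not factor through the norm map to $\mathbb{F}_{2^d}^\times$ for any divisor $d$ of $n$ with $d<n$. -}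

module Defs where

open import Data.Nat as ℕ using (ℕ; zero; suc; NonZero; _^_; _∸_)
open import Data.Integer as ℤ using (ℤ; +_; _%ℕ_)
open import Data.Fin as Fin using (Fin; toℕ)
open import Data.List using (List; []; _∷_; map; foldr; upTo; allFin; filter; length)
open import Data.List.Membership.Propositional using (_∈_)
open import Data.List.Relation.Unary.Unique.Propositional using (Unique)
open import Data.Product using (Σ; ∃; _×_; _,_)
open import Relation.Binary.PropositionalEquality using (_≡_; _≢_)
open import Relation.Binary.Definitions using (DecidableEquality)
open import Relation.Nullary using (¬_; ¬?; yes; no)
open import Algebra.Structures using (IsCommutativeRing)

-- A finite field with exactly q elements (any model; all fields with
-- 2^n elements are isomorphic, so this models F_{2^n}).

record FiniteField (q : ℕ) : Set₁ where
  field
    F      : Set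
    _≟_    : DecidableEquality F
    0F 1F  : F
    _+F_   : F → F → F
    _*F_   : F → F → F
    -F_    : F → F
    isCommutativeRing : IsCommutativeRing _≡_ _+F_ _*F_ -F_ 0F 1F
    0≢1    : 0F ≢ 1F
    inverse : ∀ x → x ≢ 0F → ∃ λ y → (x *F y) ≡ 1F
    elements          : List F
    elements-unique   : Unique elements
    elements-complete : ∀ x → x ∈ elements
    elements-length   : length elements ≡ q

module FieldOps {q : ℕ} (𝔽 : FiniteField q) where
  open FiniteField 𝔽

  powF : F → ℕ → F
  powF x zero    = 1F
  powF x (suc k) = x *F powF x k

  sumF : List F → F
  sumF = foldr _+F_ 0F

  prodF : List F → F
  prodF = foldr _*F_ 1F

  units : List F
  units = filter (λ x → ¬? (x ≟ 0F)) elements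

  Tr : ℕ → F → F
  Tr n x = sumF (map (λ i → powF x (2 ^ i)) (upTo n))

  -- ψ : nontrivial additive character of F_2 = {0F,1F} ⊆ F, ψ(0)=1, ψ(1)=-1
  ψ : F → ℤ
  ψ y with y ≟ 0F
  ... | yes _ = + 1
  ... | no  _ = ℤ.- (+ 1)

  -- Norm map from F_{2^n} to its subfield F_{2^d}, where n = d * e:
  --   N(x) = Π_{i<e} x^((2^d)^i)
  Norm : (d e : ℕ) → F → F
  Norm d e x = prodF (map (λ i → powF x ((2 ^ d) ^ i)) (upTo e))

-- Elements are represented by coefficient vectors c : Fin m → ℤ,
-- standing for Σ_i c_i ζ^i (i.e. elements of Z[x]/(x^m - 1)); two
-- representatives are equal in Z[ζ_m] iff their difference is a
-- multiple of Φ_m = 1 + x + ... + x^(m-1) (the m-th cyclotomic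
-- polynomial for m prime) in Z[x]/(x^m - 1).

module Cyclo (m : ℕ) {{nz : NonZero m}} where

  Zζ : Set
  Zζ = Fin m → ℤ

  sumℤ : List ℤ → ℤ
  sumℤ = foldr ℤ._+_ (+ 0)

  0ζ : Zζ
  0ζ _ = + 0

  _⊕_ : Zζ → Zζ → Zζ
  (a ⊕ b) i = a i ℤ.+ b i

  _·_ : ℤ → Zζ → Zζ
  (c · a) i = c ℤ.* a i

  _⊛_ : Zζ → Zζ → Zζ
  (a ⊛ b) i = sumℤ (map (λ j → sumℤ (map (λ k → term j k) (allFin m))) (allFin m))
    where
    term : Fin m → Fin m → ℤ
    term j k with (toℕ j ℕ.+ toℕ k) ℕ.% m ℕ.≟ toℕ i
    ... | yes _ = a j ℤ.* b k
    ... | no  _ = + 0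

  Φ : Zζ
  Φ _ = + 1

  _≈_ : Zζ → Zζ → Set
  a ≈ b = ∃ λ (t : Zζ) → ∀ i → a i ℤ.- b i ≡ (Φ ⊛ t) i

  ζ^ : ℤ → Zζ
  ζ^ e i with toℕ i ℕ.≟ (e %ℕ m)
  ... | yes _ = + 1
  ... | no  _ = + 0

module Setting (n : ℕ) {{nz : NonZero (2 ^ n ∸ 1)}} (𝔽 : FiniteField (2 ^ n)) where
  open FiniteField 𝔽
  open FieldOps 𝔽
  open Cyclo (2 ^ n ∸ 1)

  m : ℕ
  m = 2 ^ n ∸ 1

  -- A reduction map π : Z[ζ_m] → O/𝔭 ≅ F (for a prime 𝔭 above 2) is the
  -- ring map determined by ζ ↦ r, which is well defined iff Φ_m(r) = 0.
  IsReductionRoot : F → Set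
  IsReductionRoot r = sumF (map (powF r) (upTo m)) ≡ 0F

  -- Teichmüller character w.r.t. the reduction ζ ↦ r: ω(u) = ζ^(ω u),
  -- characterised by ω(u) ≡ u mod 𝔭, i.e. π(ζ^(ω u)) = r^(ω u) = u.
  IsTeichmuller : F → (F → ℕ) → Set
  IsTeichmuller r ω = ∀ u → u ≢ 0F → powF r (ω u) ≡ u

  ωNeg : (F → ℕ) → ℤ → F → Zζ
  ωNeg ω α u = ζ^ (ℤ.- (α ℤ.* + ω u))

  S : (F → Zζ) → Zζ
  S χ = foldr _⊕_ 0ζ (map (λ x → ψ (Tr n x) · χ x) units)

  FactorsThroughNorm : (F → Zζ) → ℕ → ℕ → Set
  FactorsThroughNorm χ d e = ∃ λ (g : F → Zζ) → ∀ x → x ≢ 0F → χ x ≈ g (Norm d e x)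

  Regular : (F → Zζ) → Set
  Regular χ = ¬ (Σ ℕ λ d → Σ ℕ λ e → (n ≡ d ℕ.* e) × (d ℕ.< n) × FactorsThroughNorm χ d e)

-- Reduction modulo 𝔭 sends ζ to an element r of prime order m = 2ⁿ - 1, and ω(u) is the
-- logarithm of u to the base r.  Hence -1 = r^ω(-1) satisfies (-1)^m = 1, so F has
-- characteristic 2 (m is odd) and Tr takes values in 𝔽₂ on units.  If m ∣ α the character
-- ω^(-α) is trivial, so regularity gives m ∤ α; then the coefficient of S(ω^(-α)) at
-- -αω(x) mod m is ψ(Tr x).  Choose μ with αμ ≡ β.  Two elements of ℤ[ζ] are equal when
-- their coefficient vectors differ by a multiple of Φ = 1 + ζ + ⋯ + ζ^(m-1), i.e. by a
-- constant; comparing coefficients at x = r^(μk) and r^k, and using k = 0, gives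
-- Tr(r^(μk)) = Tr(r^k) for all k.  Finally Σ_u r^(-u) Tr(r^(μu)) = Σ_i Σ_u r^(u(μ2^i - 1))
-- vanishes unless μ2^i ≡ 1 (mod m) for some i < n, and equals 1 for μ = 1; so μ2^j ≡ 1
-- for some j, and α ≡ αμ2^j ≡ 2^j β.

module Submission where

open import Defs
open import Data.Nat using (ℕ; _^_; _∸_; _<_)
open import Data.Nat.Primality using (Prime; prime⇒nonZero)
open import Data.Integer using (ℤ; +_; _-_; _*_)
open import Data.Integer.Divisibility using (_∣_)
open import Data.Product using (∃)

import Data.Nat as ℕ
import Data.Nat.Properties as ℕ
import Data.Nat.DivMod as ℕ
import Data.Nat.Divisibility as ℕ
open import Data.Nat.Coprimality using (Coprime; coprime-Bézout; prime⇒coprime)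
open import Data.Nat.GCD using (module Bézout)
open import Data.Nat.Primality using (euclidsLemma; ¬prime[0]; ¬prime[1])
import Data.Integer as ℤ
import Data.Integer.Properties as ℤ
open import Data.Integer.DivMod using (a≡a%ℕn+[a/ℕn]*n; n%ℕd<d)
import Data.Integer.Divisibility.Signed as Signed
open import Data.Integer.Tactic.RingSolver using (solve-∀)
import Data.Nat.Tactic.RingSolver as ℕSolver
open import Algebra.Properties.Ring ℤ.+-*-ring using (x[y-z]≈xy-xz)
open import Data.List using (List; []; _∷_; map; foldr; upTo; applyUpTo; allFin)
open import Data.List.Properties using (map-cong)
open import Data.List.Membership.Propositional.Properties using (∈-allFin; ∈-filter⁺; ∈-filter⁻)
import Data.List.Relation.Unary.Unique.Propositional.Properties as Unique
open import Data.List.Membership.Propositional using (_∈_)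
open import Data.List.Relation.Unary.Any using (here; there)
open import Data.List.Relation.Unary.All using () renaming (lookup to lookupAll)
open import Data.List.Relation.Unary.AllPairs using (_∷_)
open import Data.List.Relation.Unary.Unique.Propositional using (Unique)
open import Data.Product using (_,_; proj₁; proj₂)
open import Data.Sum using (_⊎_; inj₁; inj₂)
import Data.Sum as Sum
open import Data.Empty using (⊥-elim)
open import Function using (_∘_; id; case_of_)
open import Data.Fin using (Fin; zero; suc; toℕ; fromℕ<)
import Data.Fin.Properties as Fin
open import Relation.Nullary using (¬_; ¬?; yes; no)
open import Relation.Binary.PropositionalEquality
open import Algebra.Bundles using (CommutativeRing)
open import Level using (0ℓ)
open import Data.Maybe using (nothing)
open import Tactic.RingSolver.Core.AlmostCommutativeRing using (fromCommutativeRing)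

-- Sums of integers

module _ where

  open import Data.Integer using (_+_)
  open import Algebra.Properties.CommutativeSemigroup ℤ.+-commutativeSemigroup using (interchange)

  sumℤ : List ℤ → ℤ
  sumℤ = foldr ℤ._+_ (+ 0)

  module _ {A : Set} where

    sumℤ-map-zero : ∀ {f : A → ℤ} xs → (∀ {x} → x ∈ xs → f x ≡ + 0) → sumℤ (map f xs) ≡ + 0
    sumℤ-map-zero []       _   = refl
    sumℤ-map-zero (x ∷ xs) f≡0 = cong₂ ℤ._+_ (f≡0 (here refl)) (sumℤ-map-zero xs (f≡0 ∘ there))

    sumℤ-map-single : ∀ {f : A → ℤ} {x} xs → Unique xs → x ∈ xs →
                      (∀ {y} → y ∈ xs → y ≢ x → f y ≡ + 0) → sumℤ (map f xs) ≡ f x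
    sumℤ-map-single {f} (x ∷ xs) (x∉xs ∷ _) (here refl) f≡0 = begin
      f x + sumℤ (map f xs) ≡⟨ cong (λ s → f x + s) (sumℤ-map-zero xs (λ y∈xs → f≡0 (there y∈xs) (lookupAll x∉xs y∈xs ∘ sym))) ⟩
      f x + + 0             ≡⟨ ℤ.+-identityʳ (f x) ⟩
      f x                     ∎
      where open ≡-Reasoning
    sumℤ-map-single {f} {x'} (x ∷ xs) (x∉xs ∷ xs!) (there x'∈xs) f≡0 = begin
      f x + sumℤ (map f xs) ≡⟨ cong₂ ℤ._+_ (f≡0 (here refl) (lookupAll x∉xs x'∈xs))
                                            (sumℤ-map-single xs xs! x'∈xs (f≡0 ∘ there)) ⟩
      + 0 + f x'            ≡⟨ ℤ.+-identityˡ (f x') ⟩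
      f x'                    ∎
      where open ≡-Reasoning

    sumℤ-map-+ : ∀ (f g : A → ℤ) xs →
                 sumℤ (map (λ x → f x + g x) xs) ≡ sumℤ (map f xs) + sumℤ (map g xs)
    sumℤ-map-+ f g []       = refl
    sumℤ-map-+ f g (x ∷ xs) =
      trans (cong (λ s → f x + g x + s) (sumℤ-map-+ f g xs)) (interchange (f x) (g x) _ _)

  sumℤ-map-comm : ∀ {A B : Set} (h : A → B → ℤ) xs ys →
                  sumℤ (map (λ x → sumℤ (map (h x) ys)) xs) ≡ sumℤ (map (λ y → sumℤ (map (λ x → h x y) xs)) ys)
  sumℤ-map-comm h []       ys = sym (sumℤ-map-zero ys (λ _ → refl))
  sumℤ-map-comm h (x ∷ xs) ys =
    trans (cong (λ s → sumℤ (map (h x) ys) + s) (sumℤ-map-comm h xs ys)) (sym (sumℤ-map-+ (h x) _ ys))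

-- Arithmetic modulo m

∣∧<⇒≡0 : ∀ {m d} → m ℕ.∣ d → d < m → d ≡ 0
∣∧<⇒≡0 {d = ℕ.zero}  _   _   = refl
∣∧<⇒≡0 {d = ℕ.suc _} m∣d d<m = ⊥-elim (ℕ.>⇒∤ d<m m∣d)

2^n∸1-odd : ∀ {n} → 0 < n → ∃ λ h → 2 ^ n ∸ 1 ≡ ℕ.suc (h ℕ.+ h)
2^n∸1-odd {ℕ.suc n} _ with 2 ^ n | ℕ.m^n>0 2 n
... | ℕ.suc p | _ = p , trans (ℕ.+-suc p (p ℕ.+ 0)) (cong (λ q → ℕ.suc (p ℕ.+ q)) (ℕ.+-identityʳ p))

2^n∸1-prime⇒1<n : ∀ n → Prime (2 ^ n ∸ 1) → 1 < n
2^n∸1-prime⇒1<n 0                   = ⊥-elim ∘ ¬prime[0]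
2^n∸1-prime⇒1<n 1                   = ⊥-elim ∘ ¬prime[1]
2^n∸1-prime⇒1<n (ℕ.suc (ℕ.suc n)) _ = ℕ.s≤s (ℕ.s≤s ℕ.z≤n)

∣m∸1+x⇒x%m≡1%m : ∀ {m x} .{{_ : ℕ.NonZero m}} → m ℕ.∣ m ∸ 1 ℕ.+ x → x ℕ.% m ≡ 1 ℕ.% m
∣m∸1+x⇒x%m≡1%m {m} {x} m∣m∸1+x = begin
  x ℕ.% m                    ≡⟨ ℕ.[m+n]%n≡m%n x m ⟨
  (x ℕ.+ m) ℕ.% m            ≡⟨ cong (λ y → (x ℕ.+ y) ℕ.% m) (ℕ.m∸n+n≡m (ℕ.>-nonZero⁻¹ m)) ⟨
  (x ℕ.+ (m ∸ 1 ℕ.+ 1)) ℕ.% m ≡⟨ cong (ℕ._% m) (rearrange x (m ∸ 1)) ⟩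
  (m ∸ 1 ℕ.+ x ℕ.+ 1) ℕ.% m  ≡⟨ ℕ.%-remove-+ˡ 1 m∣m∸1+x ⟩
  1 ℕ.% m                    ∎
  where
  open ≡-Reasoning
  rearrange : ∀ x y → x ℕ.+ (y ℕ.+ 1) ≡ y ℕ.+ x ℕ.+ 1
  rearrange = ℕSolver.solve-∀

m∤m∸1+2^i : ∀ {n i} → 0 < i → i < n → ¬ (2 ^ n ∸ 1 ℕ.∣ 2 ^ n ∸ 1 ∸ 1 ℕ.+ 1 ℕ.* 2 ^ i)
m∤m∸1+2^i {n} {i} 0<i i<n m∣ = ℕ.>⇒∤ {{ℕ.>-nonZero 0<2^i∸1}} 2^i∸1<m (ℕ.∣m+n∣m⇒∣n (subst (m ℕ.∣_) shift m∣) ℕ.∣-refl)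
  where
  m : ℕ
  m = 2 ^ n ∸ 1
  2≤2^i : 2 ℕ.≤ 2 ^ i
  2≤2^i = ℕ.^-monoʳ-≤ 2 0<i
  0<2^i∸1 : 0 < 2 ^ i ∸ 1
  0<2^i∸1 = ℕ.∸-monoˡ-< 2≤2^i (ℕ.s≤s ℕ.z≤n)
  2^i∸1<m : 2 ^ i ∸ 1 < m
  2^i∸1<m = ℕ.∸-monoˡ-< (ℕ.^-monoʳ-< 2 (ℕ.s≤s (ℕ.s≤s ℕ.z≤n)) i<n) (ℕ.<⇒≤ 2≤2^i)
  shift : m ∸ 1 ℕ.+ 1 ℕ.* 2 ^ i ≡ m ℕ.+ (2 ^ i ∸ 1)
  shift = begin
    m ∸ 1 ℕ.+ 1 ℕ.* 2 ^ i         ≡⟨ cong (m ∸ 1 ℕ.+_) (trans (ℕ.*-identityˡ (2 ^ i)) (sym (ℕ.m+[n∸m]≡n (ℕ.<⇒≤ 2≤2^i)))) ⟩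
    m ∸ 1 ℕ.+ (1 ℕ.+ (2 ^ i ∸ 1)) ≡⟨ ℕ.+-assoc (m ∸ 1) 1 _ ⟨
    m ∸ 1 ℕ.+ 1 ℕ.+ (2 ^ i ∸ 1)   ≡⟨ cong (ℕ._+ (2 ^ i ∸ 1)) (ℕ.m∸n+n≡m (ℕ.<⇒≤ (ℕ.≤-<-trans 0<2^i∸1 2^i∸1<m))) ⟩
    m ℕ.+ (2 ^ i ∸ 1)             ∎
    where open ≡-Reasoning

module Residues (m : ℕ) .{{_ : ℕ.NonZero m}} where

  open import Data.Integer using (_+_)

  private
    shift : ∀ r A B M → (r + A * M) - (r + B * M) ≡ (A - B) * M
    shift = solve-∀

    neg-minus : ∀ a b → ℤ.- (a - b) ≡ b - a
    neg-minus = solve-∀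

  %ℕ≡⇒∣- : ∀ a b → a ℤ.%ℕ m ≡ b ℤ.%ℕ m → + m Signed.∣ a - b
  %ℕ≡⇒∣- a b eq = Signed.divides (a ℤ./ℕ m - b ℤ./ℕ m) (begin
    a - b                                      ≡⟨ cong₂ _-_ (a≡a%ℕn+[a/ℕn]*n a m) (a≡a%ℕn+[a/ℕn]*n b m) ⟩
    (+ (a ℤ.%ℕ m) + a ℤ./ℕ m * + m) - (+ (b ℤ.%ℕ m) + b ℤ./ℕ m * + m)
                                               ≡⟨ cong (λ r → (+ r + a ℤ./ℕ m * + m) - (+ (b ℤ.%ℕ m) + b ℤ./ℕ m * + m)) eq ⟩
    (+ (b ℤ.%ℕ m) + a ℤ./ℕ m * + m) - (+ (b ℤ.%ℕ m) + b ℤ./ℕ m * + m)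
                                               ≡⟨ shift (+ (b ℤ.%ℕ m)) (a ℤ./ℕ m) (b ℤ./ℕ m) (+ m) ⟩
    (a ℤ./ℕ m - b ℤ./ℕ m) * + m                ∎)
    where open ≡-Reasoning

  private
    ∣-∧≤∧<⇒≡ : ∀ {x y} → x ℕ.≤ y → y < m → + m Signed.∣ + x - + y → x ≡ y
    ∣-∧≤∧<⇒≡ {x} {y} x≤y y<m m∣x-y =
      ℕ.≤-antisym x≤y (ℕ.m∸n≡0⇒m≤n (∣∧<⇒≡0 m∣y∸x (ℕ.≤-<-trans (ℕ.m∸n≤m y x) y<m)))
      where
      m∣y∸x : m ℕ.∣ y ∸ x
      m∣y∸x = subst (m ℕ.∣_) (trans (cong ℤ.∣_∣ (ℤ.m-n≡m⊖n x y)) (ℤ.∣⊖∣-≤ x≤y)) (Signed.∣⇒∣ᵤ m∣x-y)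

  ∣-∧<⇒≡ : ∀ {x y} → x < m → y < m → + m Signed.∣ + x - + y → x ≡ y
  ∣-∧<⇒≡ {x} {y} x<m y<m m∣x-y with ℕ.≤-total x y
  ... | inj₁ x≤y = ∣-∧≤∧<⇒≡ x≤y y<m m∣x-y
  ... | inj₂ y≤x = sym (∣-∧≤∧<⇒≡ y≤x x<m (subst (+ m Signed.∣_) (neg-minus (+ x) (+ y)) (Signed.∣m⇒∣-m m∣x-y)))

  ∣-⇒%ℕ≡ : ∀ a b → + m Signed.∣ a - b → a ℤ.%ℕ m ≡ b ℤ.%ℕ m
  ∣-⇒%ℕ≡ a b m∣a-b = ∣-∧<⇒≡ (n%ℕd<d a m) (n%ℕd<d b m) m∣a%-b%
    where
    A B : ℤ
    A = a ℤ./ℕ m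
    B = b ℤ./ℕ m
    unshift : ∀ r s A B M → r - s ≡ ((r + A * M) - (s + B * M)) - (A - B) * M
    unshift = solve-∀
    a%-b%≡ : + (a ℤ.%ℕ m) - + (b ℤ.%ℕ m) ≡ (a - b) - (A - B) * + m
    a%-b%≡ = trans (unshift (+ (a ℤ.%ℕ m)) (+ (b ℤ.%ℕ m)) A B (+ m))
                   (cong (λ d → d - (A - B) * + m) (sym (cong₂ _-_ (a≡a%ℕn+[a/ℕn]*n a m) (a≡a%ℕn+[a/ℕn]*n b m))))
    m∣a%-b% : + m Signed.∣ + (a ℤ.%ℕ m) - + (b ℤ.%ℕ m)
    m∣a%-b% = subst (+ m Signed.∣_) (sym a%-b%≡) (Signed.∣m∣n⇒∣m-n m∣a-b (Signed.∣n⇒∣m*n (A - B) Signed.∣-refl))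

  %ℕ≡0⇒∣ : ∀ a → a ℤ.%ℕ m ≡ 0 → + m Signed.∣ a
  %ℕ≡0⇒∣ a a%m≡0 = subst (+ m Signed.∣_) (ℤ.+-identityʳ a)
                     (%ℕ≡⇒∣- a (+ 0) (trans a%m≡0 (sym (ℕ.m*n%n≡0 0 m))))

  %ℕ-congˡ-* : ∀ c {a b} → a ℤ.%ℕ m ≡ b ℤ.%ℕ m → (c * a) ℤ.%ℕ m ≡ (c * b) ℤ.%ℕ m
  %ℕ-congˡ-* c {a} {b} eq = ∣-⇒%ℕ≡ (c * a) (c * b)
    (subst (+ m Signed.∣_) (x[y-z]≈xy-xz c a b) (Signed.∣n⇒∣m*n c (%ℕ≡⇒∣- a b eq)))

  aμ≡b∧μc≡1⇒a≡cb : ∀ {a b μ c} → (a * + μ) ℤ.%ℕ m ≡ b ℤ.%ℕ m → (μ ℕ.* c) ℕ.% m ≡ 1 ℕ.% m →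
                    a ℤ.%ℕ m ≡ (+ c * b) ℤ.%ℕ m
  aμ≡b∧μc≡1⇒a≡cb {a} {b} {μ} {c} aμ≡b μc≡1 = begin
    a ℤ.%ℕ m                   ≡⟨ cong (ℤ._%ℕ m) (ℤ.*-identityʳ a) ⟨
    (a * + 1) ℤ.%ℕ m           ≡⟨ %ℕ-congˡ-* a (sym μc≡1) ⟩
    (a * + (μ ℕ.* c)) ℤ.%ℕ m   ≡⟨ cong (ℤ._%ℕ m) (trans (cong (a *_) (ℤ.pos-* μ c)) (rearrange a (+ μ) (+ c))) ⟩
    (+ c * (a * + μ)) ℤ.%ℕ m   ≡⟨ %ℕ-congˡ-* (+ c) aμ≡b ⟩
    (+ c * b) ℤ.%ℕ m           ∎
    where
    open ≡-Reasoning
    rearrange : ∀ a μ c → a * (μ * c) ≡ c * (a * μ)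
    rearrange = solve-∀

module PrimeResidues {m : ℕ} (m-prime : Prime m) where

  private instance
    m≢0 : ℕ.NonZero m
    m≢0 = prime⇒nonZero m-prime

  open Residues m
  open import Data.Integer using (_+_)

  ∣*⇒∣⊎∣ : ∀ a b → + m Signed.∣ a * b → + m Signed.∣ a ⊎ + m Signed.∣ b
  ∣*⇒∣⊎∣ a b m∣ab = Sum.map Signed.∣ᵤ⇒∣ Signed.∣ᵤ⇒∣
    (euclidsLemma ℤ.∣ a ∣ ℤ.∣ b ∣ m-prime (subst (m ℕ.∣_) (ℤ.abs-* a b) (Signed.∣⇒∣ᵤ m∣ab)))

  %ℕ-inverse : ∀ a → ¬ (+ m Signed.∣ a) → ∃ λ ν → (a * ν) ℤ.%ℕ m ≡ (+ 1) ℤ.%ℕ m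
  %ℕ-inverse a m∤a with a ℤ.%ℕ m in a%m≡
  ... | ℕ.zero  = ⊥-elim (m∤a (%ℕ≡0⇒∣ a a%m≡))
  ... | ℕ.suc k = from-Bézout (coprime-Bézout (prime⇒coprime m-prime a₀<m))
    where
    a₀ : ℕ
    a₀ = ℕ.suc k
    a₀<m : a₀ < m
    a₀<m = subst (_< m) a%m≡ (n%ℕd<d a m)
    a≡a₀ : a ℤ.%ℕ m ≡ (+ a₀) ℤ.%ℕ m
    a≡a₀ = trans a%m≡ (sym (ℕ.m<n⇒m%n≡m a₀<m))
    lift : ∀ {x y u v} → 1 ℕ.+ x ℕ.* y ≡ u ℕ.* v → + 1 + + x * + y ≡ + u * + v
    lift {x} {y} {u} {v} eq = begin
      + 1 + + x * + y     ≡⟨ cong (λ z → + 1 + z) (ℤ.pos-* x y) ⟨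
      + 1 + + (x ℕ.* y)   ≡⟨ ℤ.pos-+ 1 (x ℕ.* y) ⟨
      + (1 ℕ.+ x ℕ.* y)   ≡⟨ cong +_ eq ⟩
      + (u ℕ.* v)         ≡⟨ ℤ.pos-* u v ⟩
      + u * + v           ∎
      where open ≡-Reasoning
    inverse-of-a₀ : ∀ ν → + m Signed.∣ + a₀ * ν - + 1 → ∃ λ ν → (a * ν) ℤ.%ℕ m ≡ (+ 1) ℤ.%ℕ m
    inverse-of-a₀ ν m∣a₀ν-1 = ν , (begin
      (a * ν) ℤ.%ℕ m    ≡⟨ cong (ℤ._%ℕ m) (ℤ.*-comm a ν) ⟩
      (ν * a) ℤ.%ℕ m    ≡⟨ %ℕ-congˡ-* ν a≡a₀ ⟩
      (ν * + a₀) ℤ.%ℕ m ≡⟨ cong (ℤ._%ℕ m) (ℤ.*-comm ν (+ a₀)) ⟩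
      (+ a₀ * ν) ℤ.%ℕ m ≡⟨ ∣-⇒%ℕ≡ (+ a₀ * ν) (+ 1) m∣a₀ν-1 ⟩
      (+ 1) ℤ.%ℕ m      ∎)
      where open ≡-Reasoning
    from-Bézout : Bézout.Identity 1 m a₀ → ∃ λ ν → (a * ν) ℤ.%ℕ m ≡ (+ 1) ℤ.%ℕ m
    from-Bézout (Bézout.+- x y 1+ya₀≡xm) = inverse-of-a₀ (ℤ.- + y)
      (Signed.divides (ℤ.- + x) (trans (rearrange (+ a₀) (+ y)) (trans (cong ℤ.-_ (lift {y} {a₀} {x} {m} 1+ya₀≡xm)) (ℤ.neg-distribˡ-* (+ x) (+ m)))))
      where
      rearrange : ∀ A Y → A * ℤ.- Y - + 1 ≡ ℤ.- (+ 1 + Y * A)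
      rearrange = solve-∀
    from-Bézout (Bézout.-+ x y 1+xm≡ya₀) = inverse-of-a₀ (+ y)
      (Signed.divides (+ x) (trans (cong (_- + 1) (trans (ℤ.*-comm (+ a₀) (+ y)) (sym (lift {x} {m} {y} {a₀} 1+xm≡ya₀)))) (cancel (+ x * + m))))
      where
      cancel : ∀ z → (+ 1 + z) - + 1 ≡ z
      cancel = solve-∀

  %ℕ-linear-solution : ∀ a b → ¬ (+ m Signed.∣ a) → ∃ λ μ → (a * + μ) ℤ.%ℕ m ≡ b ℤ.%ℕ m
  %ℕ-linear-solution a b m∤a with %ℕ-inverse a m∤a
  ... | ν , aν≡1 = (ν * b) ℤ.%ℕ m , (begin
    (a * + ((ν * b) ℤ.%ℕ m)) ℤ.%ℕ m  ≡⟨ %ℕ-congˡ-* a (ℕ.m<n⇒m%n≡m (n%ℕd<d (ν * b) m)) ⟩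
    (a * (ν * b)) ℤ.%ℕ m             ≡⟨ cong (ℤ._%ℕ m) (reassociate a ν b) ⟩
    (b * (a * ν)) ℤ.%ℕ m             ≡⟨ %ℕ-congˡ-* b aν≡1 ⟩
    (b * + 1) ℤ.%ℕ m                 ≡⟨ cong (ℤ._%ℕ m) (ℤ.*-identityʳ b) ⟩
    b ℤ.%ℕ m                         ∎)
    where
    open ≡-Reasoning
    reassociate : ∀ a ν b → a * (ν * b) ≡ b * (a * ν)
    reassociate = solve-∀

-[ap]+aq≡a[q-p] : ∀ a p q → ℤ.- (a * p) - ℤ.- (a * q) ≡ a * (q - p)
-[ap]+aq≡a[q-p] = solve-∀

-[a[kμ]]≡-k[aμ] : ∀ a k μ → ℤ.- (a * (k * μ)) ≡ ℤ.- k * (a * μ)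
-[a[kμ]]≡-k[aμ] = solve-∀

-k*b≡-[bk] : ∀ k b → ℤ.- k * b ≡ ℤ.- (b * k)
-k*b≡-[bk] = solve-∀

-- Coefficient vectors in ℤ[ζ]

module CyclotomicLemmas (m : ℕ) {{_ : ℕ.NonZero m}} where

  open Cyclo m using (Zζ; 0ζ; _⊕_; Φ; _⊛_; ζ^)

  ⊕-foldr-coefficient : ∀ {A : Set} (h : A → Zζ) xs i → foldr _⊕_ 0ζ (map h xs) i ≡ sumℤ (map (λ x → h x i) xs)
  ⊕-foldr-coefficient h []       i = refl
  ⊕-foldr-coefficient h (x ∷ xs) i = cong (ℤ._+_ (h x i)) (⊕-foldr-coefficient h xs i)

  ζ^-at : ∀ e i → toℕ i ≡ e ℤ.%ℕ m → ζ^ e i ≡ + 1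
  ζ^-at e i i≡e with toℕ i ℕ.≟ e ℤ.%ℕ m
  ... | yes _   = refl
  ... | no  i≢e = ⊥-elim (i≢e i≡e)

  ζ^-off : ∀ e i → toℕ i ≢ e ℤ.%ℕ m → ζ^ e i ≡ + 0
  ζ^-off e i i≢e with toℕ i ℕ.≟ e ℤ.%ℕ m
  ... | yes i≡e = ⊥-elim (i≢e i≡e)
  ... | no  _   = refl

  ζ^-cong : ∀ {e e'} → e ℤ.%ℕ m ≡ e' ℤ.%ℕ m → ∀ i → ζ^ e i ≡ ζ^ e' i
  ζ^-cong {e} {e'} e≡e' i with toℕ i ℕ.≟ e ℤ.%ℕ m
  ... | yes i≡e = sym (ζ^-at e' i (trans i≡e e≡e'))
  ... | no  i≢e = sym (ζ^-off e' i (i≢e ∘ (λ i≡e' → trans i≡e' (sym e≡e'))))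

  private
    [[a+b]%m+c]%m≡a%m : ∀ a {b c} → b ℕ.+ c ≡ m → ((a ℕ.+ b) ℕ.% m ℕ.+ c) ℕ.% m ≡ a ℕ.% m
    [[a+b]%m+c]%m≡a%m a {b} {c} b+c≡m = begin
      ((a ℕ.+ b) ℕ.% m ℕ.+ c) ℕ.% m                  ≡⟨ ℕ.%-distribˡ-+ ((a ℕ.+ b) ℕ.% m) c m ⟩
      ((a ℕ.+ b) ℕ.% m ℕ.% m ℕ.+ c ℕ.% m) ℕ.% m      ≡⟨ cong (λ x → (x ℕ.+ c ℕ.% m) ℕ.% m) (ℕ.m%n%n≡m%n (a ℕ.+ b) m) ⟩
      ((a ℕ.+ b) ℕ.% m ℕ.+ c ℕ.% m) ℕ.% m            ≡⟨ ℕ.%-distribˡ-+ (a ℕ.+ b) c m ⟨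
      (a ℕ.+ b ℕ.+ c) ℕ.% m                          ≡⟨ cong (ℕ._% m) (trans (ℕ.+-assoc a b c) (cong (a ℕ.+_) b+c≡m)) ⟩
      (a ℕ.+ m) ℕ.% m                                ≡⟨ ℕ.[m+n]%n≡m%n a m ⟩
      a ℕ.% m                                        ∎
      where open ≡-Reasoning

  minusMod : Fin m → Fin m → Fin m
  minusMod i k = fromℕ< (ℕ.m%n<n (toℕ i ℕ.+ (m ∸ toℕ k)) m)

  minusMod-solves : ∀ i k → (toℕ (minusMod i k) ℕ.+ toℕ k) ℕ.% m ≡ toℕ i
  minusMod-solves i k = begin
    (toℕ (minusMod i k) ℕ.+ toℕ k) ℕ.% m                 ≡⟨ cong (λ x → (x ℕ.+ toℕ k) ℕ.% m) (Fin.toℕ-fromℕ< _) ⟩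
    ((toℕ i ℕ.+ (m ∸ toℕ k)) ℕ.% m ℕ.+ toℕ k) ℕ.% m      ≡⟨ [[a+b]%m+c]%m≡a%m (toℕ i) (ℕ.m∸n+n≡m (ℕ.<⇒≤ (Fin.toℕ<n k))) ⟩
    toℕ i ℕ.% m                                         ≡⟨ ℕ.m<n⇒m%n≡m (Fin.toℕ<n i) ⟩
    toℕ i                                               ∎
    where open ≡-Reasoning

  minusMod-unique : ∀ i k j → (toℕ j ℕ.+ toℕ k) ℕ.% m ≡ toℕ i → j ≡ minusMod i k
  minusMod-unique i k j j+k≡i = Fin.toℕ-injective (begin
    toℕ j                                               ≡⟨ ℕ.m<n⇒m%n≡m (Fin.toℕ<n j) ⟨
    toℕ j ℕ.% m                                         ≡⟨ [[a+b]%m+c]%m≡a%m (toℕ j) (ℕ.m+[n∸m]≡n (ℕ.<⇒≤ (Fin.toℕ<n k))) ⟨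
    ((toℕ j ℕ.+ toℕ k) ℕ.% m ℕ.+ (m ∸ toℕ k)) ℕ.% m      ≡⟨ cong (λ x → (x ℕ.+ (m ∸ toℕ k)) ℕ.% m) j+k≡i ⟩
    (toℕ i ℕ.+ (m ∸ toℕ k)) ℕ.% m                       ≡⟨ Fin.toℕ-fromℕ< _ ⟨
    toℕ (minusMod i k)                                  ∎)
    where open ≡-Reasoning

  Φ⊛-summand : Fin m → Fin m → Fin m → ℤ → ℤ
  Φ⊛-summand i j k x with (toℕ j ℕ.+ toℕ k) ℕ.% m ℕ.≟ toℕ i
  ... | yes _ = x
  ... | no  _ = + 0

  Φ⊛-summand-on : ∀ i j k x → (toℕ j ℕ.+ toℕ k) ℕ.% m ≡ toℕ i → Φ⊛-summand i j k x ≡ x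
  Φ⊛-summand-on i j k x j+k≡i with (toℕ j ℕ.+ toℕ k) ℕ.% m ℕ.≟ toℕ i
  ... | yes _     = refl
  ... | no  j+k≢i = ⊥-elim (j+k≢i j+k≡i)

  Φ⊛-summand-off : ∀ i j k x → (toℕ j ℕ.+ toℕ k) ℕ.% m ≢ toℕ i → Φ⊛-summand i j k x ≡ + 0
  Φ⊛-summand-off i j k x j+k≢i with (toℕ j ℕ.+ toℕ k) ℕ.% m ℕ.≟ toℕ i
  ... | yes j+k≡i = ⊥-elim (j+k≢i j+k≡i)
  ... | no  _     = refl

  mutual
    Φ⊛-expand : ∀ t i →
      (Φ ⊛ t) i ≡ sumℤ (map (λ j → sumℤ (map (λ k → Φ⊛-summand i j k (t k)) (allFin m))) (allFin m))
    Φ⊛-expand t i = cong sumℤ (map-cong (λ j → cong sumℤ (map-cong (Φ⊛-entry t i j) (allFin m))) (allFin m))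

    -- Its type involves the summand bound in the where-block of _⊛_, which cannot be named;
    -- it is inferred from the use in Φ⊛-expand.
    Φ⊛-entry : ∀ t i j k → _
    Φ⊛-entry t i j k with (toℕ j ℕ.+ toℕ k) ℕ.% m ℕ.≟ toℕ i
    ... | yes _ = ℤ.*-identityˡ (t k)
    ... | no  _ = refl

  Φ⊛-constant : ∀ t i → (Φ ⊛ t) i ≡ sumℤ (map t (allFin m))
  Φ⊛-constant t i = begin
    (Φ ⊛ t) i
      ≡⟨ Φ⊛-expand t i ⟩
    sumℤ (map (λ j → sumℤ (map (λ k → Φ⊛-summand i j k (t k)) (allFin m))) (allFin m))
      ≡⟨ sumℤ-map-comm (λ j k → Φ⊛-summand i j k (t k)) (allFin m) (allFin m) ⟩
    sumℤ (map (λ k → sumℤ (map (λ j → Φ⊛-summand i j k (t k)) (allFin m))) (allFin m))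
      ≡⟨ cong sumℤ (map-cong column (allFin m)) ⟩
    sumℤ (map t (allFin m))
      ∎
    where
    open ≡-Reasoning
    column : ∀ k → sumℤ (map (λ j → Φ⊛-summand i j k (t k)) (allFin m)) ≡ t k
    column k = trans
      (sumℤ-map-single (allFin m) (Unique.allFin⁺ m) (∈-allFin (minusMod i k))
        (λ {j} _ j≢ → Φ⊛-summand-off i j k (t k) (j≢ ∘ minusMod-unique i k j)))
      (Φ⊛-summand-on i (minusMod i k) k (t k) (minusMod-solves i k))

-- Finite fields

module FieldLemmas {q : ℕ} (𝔽 : FiniteField q) where

  open FiniteField 𝔽 using (F; _≟_; 0≢1; inverse; isCommutativeRing; elements; elements-unique; elements-complete)
  open FieldOps 𝔽 using (powF; sumF; Tr; ψ; units)

  commutativeRing : CommutativeRing 0ℓ 0ℓ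
  commutativeRing = record { isCommutativeRing = isCommutativeRing }

  open CommutativeRing commutativeRing public using (_+_; -_; 0#; 1#; *-identityʳ) renaming (_*_ to _·_)
  open CommutativeRing commutativeRing
    using ( +-comm; +-identityʳ; *-identityˡ; *-assoc; *-comm; zeroʳ
          ; +-identityˡ; -‿inverseʳ; zeroˡ; distribʳ; +-group; +-monoid; +-commutativeMonoid; semiring )
  open import Algebra.Properties.Group +-group using (∙-cancelʳ; ⁻¹-involutive)
  open import Algebra.Properties.Ring (CommutativeRing.ring commutativeRing) using (-1*x≈-x)
  open import Algebra.Properties.CommutativeSemigroup (CommutativeRing.*-commutativeSemigroup commutativeRing)
    using () renaming (interchange to ·-interchange)
  open import Algebra.Properties.Monoid.Mult +-monoid using (_×_; ×-homo-+)
  open import Algebra.Properties.CommutativeMonoid.Sum +-commutativeMonoid public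
    using (sum; sum-syntax; sum-cong-≗; sum-replicate-zero; ∑-comm)
  open import Algebra.Properties.CommutativeMonoid.Sum +-commutativeMonoid using (sum-init-last; sum-replicate)
  open import Algebra.Properties.Semiring.Sum semiring public using (*-distribˡ-sum)
  open import Tactic.RingSolver.NonReflective (fromCommutativeRing commutativeRing (λ _ → nothing))
    using (solve; _⊜_)
  open import Tactic.RingSolver.Core.Expression using (_⊕_; _⊗_)

  pow-+ : ∀ x a b → powF x (a ℕ.+ b) ≡ powF x a · powF x b
  pow-+ x ℕ.zero    b = sym (*-identityˡ (powF x b))
  pow-+ x (ℕ.suc a) b = trans (cong (x ·_) (pow-+ x a b)) (sym (*-assoc x (powF x a) (powF x b)))

  pow-* : ∀ x a b → powF x (a ℕ.* b) ≡ powF (powF x b) a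
  pow-* x ℕ.zero    b = refl
  pow-* x (ℕ.suc a) b = trans (pow-+ x b (a ℕ.* b)) (cong (powF x b ·_) (pow-* x a b))

  pow-1# : ∀ k → powF 1# k ≡ 1#
  pow-1# ℕ.zero    = refl
  pow-1# (ℕ.suc k) = trans (*-identityˡ (powF 1# k)) (pow-1# k)

  pow-distrib-· : ∀ x y k → powF (x · y) k ≡ powF x k · powF y k
  pow-distrib-· x y ℕ.zero    = sym (*-identityˡ 1#)
  pow-distrib-· x y (ℕ.suc k) = trans (cong ((x · y) ·_) (pow-distrib-· x y k)) (·-interchange x y _ _)

  pow-multiple≡1 : ∀ {x a} c → powF x a ≡ 1# → powF x (c ℕ.* a) ≡ 1#
  pow-multiple≡1 {x} {a} c x^a≡1 = trans (pow-* x c a) (trans (cong (λ y → powF y c) x^a≡1) (pow-1# c))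

  pow-pow≡1 : ∀ {x m} → powF x m ≡ 1# → ∀ k → powF (powF x k) m ≡ 1#
  pow-pow≡1 {x} {m} x^m≡1 k =
    trans (sym (pow-* x m k)) (trans (cong (powF x) (ℕ.*-comm m k)) (pow-multiple≡1 k x^m≡1))

  pow≡1⇒≢0 : ∀ {x k} → 0 < k → powF x k ≡ 1# → x ≢ 0#
  pow≡1⇒≢0 {x} {ℕ.suc k} _ x^k≡1 refl = 0≢1 (trans (sym (zeroˡ (powF 0# k))) x^k≡1)

  -1·-1≡1 : - 1# · - 1# ≡ 1#
  -1·-1≡1 = trans (-1*x≈-x (- 1#)) (⁻¹-involutive 1#)

  -1≢0 : - 1# ≢ 0#
  -1≢0 = pow≡1⇒≢0 {k = 2} (ℕ.s≤s ℕ.z≤n) (trans (cong (- 1# ·_) (*-identityʳ (- 1#))) -1·-1≡1)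

  -1^odd : ∀ h → powF (- 1#) (ℕ.suc (h ℕ.+ h)) ≡ - 1#
  -1^odd h = begin
    - 1# · powF (- 1#) (h ℕ.+ h)                ≡⟨ cong (- 1# ·_) (pow-+ (- 1#) h h) ⟩
    - 1# · (powF (- 1#) h · powF (- 1#) h)      ≡⟨ cong (- 1# ·_) (pow-distrib-· (- 1#) (- 1#) h) ⟨
    - 1# · powF (- 1# · - 1#) h                 ≡⟨ cong (λ y → - 1# · powF y h) -1·-1≡1 ⟩
    - 1# · powF 1# h                            ≡⟨ cong (- 1# ·_) (pow-1# h) ⟩
    - 1# · 1#                                   ≡⟨ *-identityʳ (- 1#) ⟩
    - 1#                                        ∎
    where open ≡-Reasoning

  -1≡1⇒1+1≡0 : - 1# ≡ 1# → 1# + 1# ≡ 0#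
  -1≡1⇒1+1≡0 -1≡1 = trans (cong (λ y → 1# + y) (sym -1≡1)) (-‿inverseʳ 1#)

  ·-cancelʳ : ∀ {x y z} → z ≢ 0# → x · z ≡ y · z → x ≡ y
  ·-cancelʳ {x} {y} {z} z≢0 xz≡yz with inverse z z≢0
  ... | w , zw≡1 = begin
    x             ≡⟨ *-identityʳ x ⟨
    x · 1#        ≡⟨ cong (x ·_) zw≡1 ⟨
    x · (z · w)   ≡⟨ *-assoc x z w ⟨
    (x · z) · w   ≡⟨ cong (_· w) xz≡yz ⟩
    (y · z) · w   ≡⟨ *-assoc y z w ⟩
    y · (z · w)   ≡⟨ cong (y ·_) zw≡1 ⟩
    y · 1#        ≡⟨ *-identityʳ y ⟩
    y             ∎
    where open ≡-Reasoning

  idempotent⇒0∨1 : ∀ {t} → t · t ≡ t → t ≡ 0# ⊎ t ≡ 1#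
  idempotent⇒0∨1 {t} tt≡t with t ≟ 0#
  ... | yes t≡0 = inj₁ t≡0
  ... | no  t≢0 = inj₂ (·-cancelʳ t≢0 (trans tt≡t (sym (*-identityˡ t))))

  sumF-map-applyUpTo : ∀ (f : ℕ → F) g k → sumF (map f (applyUpTo g k)) ≡ ∑[ i < k ] f (g (toℕ i))
  sumF-map-applyUpTo f g ℕ.zero    = refl
  sumF-map-applyUpTo f g (ℕ.suc k) = cong (λ s → f (g 0) + s) (sumF-map-applyUpTo f (g ∘ ℕ.suc) k)

  sumF-map-upTo : ∀ (f : ℕ → F) k → sumF (map f (upTo k)) ≡ ∑[ i < k ] f (toℕ i)
  sumF-map-upTo f = sumF-map-applyUpTo f id

  ∑-last : ∀ (f : ℕ → F) k → ∑[ i < ℕ.suc k ] f (toℕ i) ≡ ∑[ i < k ] f (toℕ i) + f k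
  ∑-last f k = trans (sum-init-last {k} (f ∘ toℕ))
    (cong₂ _+_ (sum-cong-≗ {k} (cong f ∘ Fin.toℕ-inject₁)) (cong f (Fin.toℕ-fromℕ k)))

  ∑-single : ∀ {k} (f : Fin k → F) i₀ → (∀ i → i ≢ i₀ → f i ≡ 0#) → sum f ≡ f i₀
  ∑-single {ℕ.suc k} f zero f≡0 = begin
    f zero + ∑[ i < k ] f (suc i)   ≡⟨ cong (λ s → f zero + s) (sum-cong-≗ {k} (λ i → f≡0 (suc i) (λ ()))) ⟩
    f zero + ∑[ i < k ] 0#              ≡⟨ cong (λ s → f zero + s) (sum-replicate-zero k) ⟩
    f zero + 0#                         ≡⟨ +-identityʳ _ ⟩
    f zero                              ∎
    where open ≡-Reasoning
  ∑-single {ℕ.suc k} f (suc i₀) f≡0 = begin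
    f zero + ∑[ i < k ] f (suc i)   ≡⟨ cong₂ _+_ (f≡0 zero (λ ())) (∑-single (f ∘ suc) i₀ (λ i i≢i₀ → f≡0 (suc i) (i≢i₀ ∘ Fin.suc-injective))) ⟩
    0# + f (suc i₀)                     ≡⟨ +-identityˡ _ ⟩
    f (suc i₀)                          ∎
    where open ≡-Reasoning

  geometricSum : F → ℕ → F
  geometricSum x k = ∑[ i < k ] powF x (toℕ i)

  geometricSum-1# : ∀ k → geometricSum 1# k ≡ ∑[ i < k ] 1#
  geometricSum-1# k = sum-cong-≗ {k} (pow-1# ∘ toℕ)

  geometricSum-identity : ∀ x k → x · geometricSum x k + 1# ≡ geometricSum x k + powF x k
  geometricSum-identity x k = begin
    x · geometricSum x k + 1#                    ≡⟨ cong (_+ 1#) (*-distribˡ-sum {k} x (λ i → powF x (toℕ i))) ⟩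
    ∑[ i < k ] powF x (ℕ.suc (toℕ i)) + 1#     ≡⟨ +-comm _ 1# ⟩
    geometricSum x (ℕ.suc k)                     ≡⟨ ∑-last (powF x) k ⟩
    geometricSum x k + powF x k                  ∎
    where open ≡-Reasoning

  geometricSum≡0⇒pow≡1 : ∀ {x k} → geometricSum x k ≡ 0# → powF x k ≡ 1#
  geometricSum≡0⇒pow≡1 {x} {k} S≡0 = begin
    powF x k                      ≡⟨ +-identityˡ (powF x k) ⟨
    0# + powF x k                 ≡⟨ cong (_+ powF x k) S≡0 ⟨
    geometricSum x k + powF x k   ≡⟨ geometricSum-identity x k ⟨
    x · geometricSum x k + 1#     ≡⟨ cong (λ S → x · S + 1#) S≡0 ⟩
    x · 0# + 1#                   ≡⟨ cong (_+ 1#) (zeroʳ x) ⟩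
    0# + 1#                       ≡⟨ +-identityˡ 1# ⟩
    1#                            ∎
    where open ≡-Reasoning

  geometricSum-rootOfUnity : ∀ {x k} → powF x k ≡ 1# → x ≢ 1# → geometricSum x k ≡ 0#
  geometricSum-rootOfUnity {x} {k} x^k≡1 x≢1 with geometricSum x k ≟ 0#
  ... | yes S≡0 = S≡0
  ... | no  S≢0 = ⊥-elim (x≢1 (·-cancelʳ S≢0 (trans xS≡S (sym (*-identityˡ _)))))
    where
    xS≡S : x · geometricSum x k ≡ geometricSum x k
    xS≡S = ∙-cancelʳ 1# _ _ (trans (geometricSum-identity x k) (cong (λ y → geometricSum x k + y) x^k≡1))

  coprime-exponents : ∀ {x a b} → Coprime a b → powF x a ≡ 1# → powF x b ≡ 1# → x ≡ 1#
  coprime-exponents {x} {a} {b} a⊥b x^a≡1 x^b≡1 with coprime-Bézout a⊥b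
  ... | Bézout.+- u v 1+vb≡ua = begin
    x                         ≡⟨ *-identityʳ x ⟨
    x · 1#                    ≡⟨ cong (x ·_) (pow-multiple≡1 v x^b≡1) ⟨
    powF x (1 ℕ.+ v ℕ.* b)    ≡⟨ cong (powF x) 1+vb≡ua ⟩
    powF x (u ℕ.* a)          ≡⟨ pow-multiple≡1 u x^a≡1 ⟩
    1#                        ∎
    where open ≡-Reasoning
  ... | Bézout.-+ u v 1+ua≡vb = begin
    x                         ≡⟨ *-identityʳ x ⟨
    x · 1#                    ≡⟨ cong (x ·_) (pow-multiple≡1 u x^a≡1) ⟨
    powF x (1 ℕ.+ u ℕ.* a)    ≡⟨ cong (powF x) 1+ua≡vb ⟩
    powF x (v ℕ.* b)          ≡⟨ pow-multiple≡1 v x^b≡1 ⟩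
    1#                        ∎
    where open ≡-Reasoning

  ψ-injective-on-𝔽₂ : ∀ {y z} → y ≡ 0# ⊎ y ≡ 1# → z ≡ 0# ⊎ z ≡ 1# → ψ y ≡ ψ z → y ≡ z
  ψ-injective-on-𝔽₂ {y} {z} y∈𝔽₂ z∈𝔽₂ ψy≡ψz with y ≟ 0# | z ≟ 0#
  ... | yes y≡0 | yes z≡0 = trans y≡0 (sym z≡0)
  ... | no  y≢0 | no  z≢0 = trans (nonzero y∈𝔽₂ y≢0) (sym (nonzero z∈𝔽₂ z≢0))
    where
    nonzero : ∀ {t} → t ≡ 0# ⊎ t ≡ 1# → t ≢ 0# → t ≡ 1#
    nonzero (inj₁ t≡0) t≢0 = ⊥-elim (t≢0 t≡0)
    nonzero (inj₂ t≡1) _   = t≡1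
  ... | yes _   | no  _   = case ψy≡ψz of λ ()
  ... | no  _   | yes _   = case ψy≡ψz of λ ()

  units-unique : Unique units
  units-unique = Unique.filter⁺ (λ x → ¬? (x ≟ 0#)) elements-unique

  ∈-units : ∀ {x} → x ≢ 0# → x ∈ units
  ∈-units {x} x≢0 = ∈-filter⁺ (λ y → ¬? (y ≟ 0#)) (elements-complete x) x≢0

  ∈-units⁻ : ∀ {x} → x ∈ units → x ≢ 0#
  ∈-units⁻ x∈units = proj₂ (∈-filter⁻ (λ y → ¬? (y ≟ 0#)) {xs = elements} x∈units)

  module Characteristic2 (1+1≡0 : 1# + 1# ≡ 0#) where

    x+x≡0 : ∀ x → x + x ≡ 0#
    x+x≡0 x = begin
      x + x             ≡⟨ cong₂ _+_ (*-identityˡ x) (*-identityˡ x) ⟨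
      1# · x + 1# · x   ≡⟨ distribʳ x 1# 1# ⟨
      (1# + 1#) · x     ≡⟨ cong (_· x) 1+1≡0 ⟩
      0# · x            ≡⟨ zeroˡ x ⟩
      0#                ∎
      where open ≡-Reasoning

    ∑-1#-odd : ∀ h → ∑[ i < ℕ.suc (h ℕ.+ h) ] 1# ≡ 1#
    ∑-1#-odd h = begin
      ∑[ i < ℕ.suc (h ℕ.+ h) ] 1#   ≡⟨ sum-replicate (ℕ.suc (h ℕ.+ h)) ⟩
      1# + (h ℕ.+ h) × 1#           ≡⟨ cong (λ s → 1# + s) (×-homo-+ 1# h h) ⟩
      1# + (h × 1# + h × 1#)        ≡⟨ cong (λ s → 1# + s) (x+x≡0 (h × 1#)) ⟩
      1# + 0#                       ≡⟨ +-identityʳ 1# ⟩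
      1#                            ∎
      where open ≡-Reasoning

    square-+ : ∀ x y → (x + y) · (x + y) ≡ x · x + y · y
    square-+ x y = begin
      (x + y) · (x + y)                 ≡⟨ expand x y ⟩
      x · x + y · y + (x · y + x · y)   ≡⟨ cong (λ s → x · x + y · y + s) (x+x≡0 (x · y)) ⟩
      x · x + y · y + 0#                ≡⟨ +-identityʳ _ ⟩
      x · x + y · y                     ∎
      where
      open ≡-Reasoning
      expand : ∀ x y → (x + y) · (x + y) ≡ x · x + y · y + (x · y + x · y)
      expand = solve 2 (λ x y → ((x ⊕ y) ⊗ (x ⊕ y)) ⊜ ((x ⊗ x ⊕ y ⊗ y) ⊕ (x ⊗ y ⊕ x ⊗ y))) refl

    square-∑ : ∀ {k} (f : Fin k → F) → sum f · sum f ≡ ∑[ i < k ] (f i · f i)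
    square-∑ {ℕ.zero}  f = zeroˡ 0#
    square-∑ {ℕ.suc k} f =
      trans (square-+ (f zero) _) (cong (λ s → f zero · f zero + s) (square-∑ (f ∘ suc)))

    Tr-idempotent : ∀ n x → powF x (2 ^ n) ≡ x → Tr n x · Tr n x ≡ Tr n x
    Tr-idempotent n x x^2^n≡x = begin
      Tr n x · Tr n x              ≡⟨ cong₂ _·_ Tr≡T Tr≡T ⟩
      T · T                        ≡⟨ square-∑ {n} (g ∘ toℕ) ⟩
      ∑[ i < n ] (g (toℕ i) · g (toℕ i))  ≡⟨ sum-cong-≗ {n} (square-g ∘ toℕ) ⟩
      A                            ≡⟨ ∙-cancelʳ (g 0) A T A+g₀≡T+g₀ ⟩
      T                            ≡⟨ Tr≡T ⟨
      Tr n x                       ∎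
      where
      open ≡-Reasoning
      g : ℕ → F
      g i = powF x (2 ^ i)
      T A : F
      T = ∑[ i < n ] g (toℕ i)
      A = ∑[ i < n ] g (ℕ.suc (toℕ i))
      Tr≡T : Tr n x ≡ T
      Tr≡T = sumF-map-upTo g n
      square-g : ∀ i → g i · g i ≡ g (ℕ.suc i)
      square-g i = trans (sym (pow-+ x (2 ^ i) (2 ^ i))) (cong (λ e → powF x (2 ^ i ℕ.+ e)) (sym (ℕ.+-identityʳ (2 ^ i))))
      g₀≡gₙ : g 0 ≡ g n
      g₀≡gₙ = trans (*-identityʳ x) (sym x^2^n≡x)
      A+g₀≡T+g₀ : A + g 0 ≡ T + g 0
      A+g₀≡T+g₀ = begin
        A + g 0    ≡⟨ +-comm A (g 0) ⟩
        g 0 + A    ≡⟨ ∑-last g n ⟩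
        T + g n    ≡⟨ cong (λ y → T + y) g₀≡gₙ ⟨
        T + g 0    ∎

  module PrimeOrder {m : ℕ} (m-prime : Prime m) {r : F} (r^m≡1 : powF r m ≡ 1#) (r≢1 : r ≢ 1#) where

    private instance
      m≢0 : ℕ.NonZero m
      m≢0 = prime⇒nonZero m-prime

    pow-% : ∀ a → powF r a ≡ powF r (a ℕ.% m)
    pow-% a = begin
      powF r a                                    ≡⟨ cong (powF r) (ℕ.m≡m%n+[m/n]*n a m) ⟩
      powF r (a ℕ.% m ℕ.+ a ℕ./ m ℕ.* m)          ≡⟨ pow-+ r (a ℕ.% m) _ ⟩
      powF r (a ℕ.% m) · powF r (a ℕ./ m ℕ.* m)   ≡⟨ cong (powF r (a ℕ.% m) ·_) (pow-multiple≡1 (a ℕ./ m) r^m≡1) ⟩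
      powF r (a ℕ.% m) · 1#                       ≡⟨ *-identityʳ _ ⟩
      powF r (a ℕ.% m)                            ∎
      where open ≡-Reasoning

    pow≡1⇒∣ : ∀ {k} → powF r k ≡ 1# → m ℕ.∣ k
    pow≡1⇒∣ {k} r^k≡1 with k ℕ.% m in k%m≡
    ... | ℕ.zero  = ℕ.m%n≡0⇒n∣m k m k%m≡
    ... | ℕ.suc j = ⊥-elim (r≢1 (coprime-exponents (prime⇒coprime m-prime k%m<m) r^m≡1 r^k%m≡1))
      where
      k%m<m : ℕ.suc j < m
      k%m<m = subst (_< m) k%m≡ (ℕ.m%n<n k m)
      r^k%m≡1 : powF r (ℕ.suc j) ≡ 1#
      r^k%m≡1 = subst (λ e → powF r e ≡ 1#) k%m≡ (trans (sym (pow-% k)) r^k≡1)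

    pow-cong : ∀ {a b} → a ℕ.% m ≡ b ℕ.% m → powF r a ≡ powF r b
    pow-cong {a} {b} eq = trans (pow-% a) (trans (cong (powF r) eq) (sym (pow-% b)))

    pow-injective : ∀ {a b} → powF r a ≡ powF r b → a ℕ.% m ≡ b ℕ.% m
    pow-injective {a} {b} r^a≡r^b = begin
      a ℕ.% m                                     ≡⟨ ℕ.[m+kn]%n≡m%n a b m ⟨
      (a ℕ.+ b ℕ.* m) ℕ.% m                       ≡⟨ cong (ℕ._% m) a+bm≡ ⟩
      (a ℕ.+ (m ∸ 1) ℕ.* b ℕ.+ b) ℕ.% m           ≡⟨ ℕ.%-remove-+ˡ b (pow≡1⇒∣ r^[a+[m-1]b]≡1) ⟩
      b ℕ.% m                                     ∎
      where
      open ≡-Reasoning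
      1+[m∸1]≡m : 1 ℕ.+ (m ∸ 1) ≡ m
      1+[m∸1]≡m = ℕ.m+[n∸m]≡n (ℕ.>-nonZero⁻¹ m)
      a+bm≡ : a ℕ.+ b ℕ.* m ≡ a ℕ.+ (m ∸ 1) ℕ.* b ℕ.+ b
      a+bm≡ = subst (λ M → a ℕ.+ b ℕ.* M ≡ a ℕ.+ (m ∸ 1) ℕ.* b ℕ.+ b) 1+[m∸1]≡m
                    (ℕ-solve-∀ a b (m ∸ 1))
        where
        ℕ-solve-∀ : ∀ a b c → a ℕ.+ b ℕ.* (1 ℕ.+ c) ≡ a ℕ.+ c ℕ.* b ℕ.+ b
        ℕ-solve-∀ = ℕSolver.solve-∀
      r^[a+[m-1]b]≡1 : powF r (a ℕ.+ (m ∸ 1) ℕ.* b) ≡ 1#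
      r^[a+[m-1]b]≡1 = begin
        powF r (a ℕ.+ (m ∸ 1) ℕ.* b)          ≡⟨ pow-+ r a _ ⟩
        powF r a · powF r ((m ∸ 1) ℕ.* b)     ≡⟨ cong (_· powF r ((m ∸ 1) ℕ.* b)) r^a≡r^b ⟩
        powF r b · powF r ((m ∸ 1) ℕ.* b)     ≡⟨ pow-+ r b _ ⟨
        powF r ((1 ℕ.+ (m ∸ 1)) ℕ.* b)        ≡⟨ cong (λ M → powF r (M ℕ.* b)) 1+[m∸1]≡m ⟩
        powF r (m ℕ.* b)                      ≡⟨ cong (powF r) (ℕ.*-comm m b) ⟩
        powF r (b ℕ.* m)                      ≡⟨ pow-multiple≡1 b r^m≡1 ⟩
        1#                                    ∎

    geometricSum-pow-∤ : ∀ {k} → ¬ (m ℕ.∣ k) → geometricSum (powF r k) m ≡ 0#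
    geometricSum-pow-∤ {k} m∤k = geometricSum-rootOfUnity {k = m} (pow-pow≡1 {r} {m} r^m≡1 k) (m∤k ∘ pow≡1⇒∣)

    geometricSum-pow-∣ : ∀ {k} → m ℕ.∣ k → geometricSum (powF r k) m ≡ ∑[ i < m ] 1#
    geometricSum-pow-∣ (ℕ.divides q refl) =
      trans (cong (λ y → geometricSum y m) (pow-multiple≡1 q r^m≡1)) (geometricSum-1# m)

module TeichmüllerSetting
  (n : ℕ) (n>0 : 0 < n) (m-prime : Prime (2 ^ n ∸ 1)) (𝔽 : FiniteField (2 ^ n))
  (r : FiniteField.F 𝔽) (root : Setting.IsReductionRoot n {{prime⇒nonZero m-prime}} 𝔽 r)
  (ω : FiniteField.F 𝔽 → ℕ) (teichmüller : Setting.IsTeichmuller n {{prime⇒nonZero m-prime}} 𝔽 r ω)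
  where

  m : ℕ
  m = 2 ^ n ∸ 1

  instance
    m≢0 : ℕ.NonZero m
    m≢0 = prime⇒nonZero m-prime

  open FiniteField 𝔽 using (F; 0≢1)
  open FieldOps 𝔽 using (powF; sumF; Tr; ψ; units)
  open FieldLemmas 𝔽
  open Setting n 𝔽 using (ωNeg; S; Regular)
  open Cyclo m using (ζ^; 0ζ; Φ; _⊛_; _≈_)
  open CyclotomicLemmas m
  open Residues m
  open PrimeResidues m-prime public using (%ℕ-linear-solution)
  open PrimeResidues m-prime using (∣*⇒∣⊎∣)

  private
    h : ℕ
    h = proj₁ (2^n∸1-odd n>0)

    m≡1+2h : m ≡ ℕ.suc (h ℕ.+ h)
    m≡1+2h = proj₂ (2^n∸1-odd n>0)

  r^m≡1 : powF r m ≡ 1#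
  r^m≡1 = geometricSum≡0⇒pow≡1 {k = m} (trans (sym (sumF-map-upTo (powF r) m)) root)

  1+1≡0 : 1# + 1# ≡ 0#
  1+1≡0 = -1≡1⇒1+1≡0 (begin
    - 1#                            ≡⟨ -1^odd h ⟨
    powF (- 1#) (ℕ.suc (h ℕ.+ h))   ≡⟨ cong (powF (- 1#)) m≡1+2h ⟨
    powF (- 1#) m                   ≡⟨ cong (λ y → powF y m) (teichmüller (- 1#) -1≢0) ⟨
    powF (powF r (ω (- 1#))) m      ≡⟨ pow-pow≡1 {r} {m} r^m≡1 (ω (- 1#)) ⟩
    1#                              ∎)
    where open ≡-Reasoning

  open Characteristic2 1+1≡0

  ∑-1#≡1 : ∑[ i < m ] 1# ≡ 1#
  ∑-1#≡1 = subst (λ k → ∑[ i < k ] 1# ≡ 1#) (sym m≡1+2h) (∑-1#-odd h)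

  r≢1 : r ≢ 1#
  r≢1 r≡1 = 0≢1 (begin
    0#                             ≡⟨ root ⟨
    sumF (map (powF r) (upTo m))   ≡⟨ sumF-map-upTo (powF r) m ⟩
    geometricSum r m               ≡⟨ cong (λ y → geometricSum y m) r≡1 ⟩
    geometricSum 1# m              ≡⟨ geometricSum-1# m ⟩
    ∑[ i < m ] 1#                  ≡⟨ ∑-1#≡1 ⟩
    1#                             ∎)
    where open ≡-Reasoning

  open PrimeOrder m-prime r^m≡1 r≢1

  pow-r≢0 : ∀ w → powF r w ≢ 0#
  pow-r≢0 w = pow≡1⇒≢0 {k = m} (ℕ.>-nonZero⁻¹ m) (pow-pow≡1 {r} {m} r^m≡1 w)

  ω-pow : ∀ w → ω (powF r w) ℕ.% m ≡ w ℕ.% m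
  ω-pow w = pow-injective (teichmüller (powF r w) (pow-r≢0 w))

  frobenius-pow : ∀ w → powF (powF r w) (2 ^ n) ≡ powF r w
  frobenius-pow w = trans (sym (pow-* r (2 ^ n) w)) (pow-cong (begin
    (2 ^ n ℕ.* w) ℕ.% m         ≡⟨ cong (λ k → (k ℕ.* w) ℕ.% m) 2^n≡1+m ⟩
    (w ℕ.+ m ℕ.* w) ℕ.% m       ≡⟨ cong (λ k → (w ℕ.+ k) ℕ.% m) (ℕ.*-comm m w) ⟩
    (w ℕ.+ w ℕ.* m) ℕ.% m       ≡⟨ ℕ.[m+kn]%n≡m%n w w m ⟩
    w ℕ.% m                     ∎))
    where
    open ≡-Reasoning
    2^n≡1+m : 2 ^ n ≡ ℕ.suc m
    2^n≡1+m = sym (ℕ.m+[n∸m]≡n (ℕ.m^n>0 2 n))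

  Tr-pow∈𝔽₂ : ∀ w → Tr n (powF r w) ≡ 0# ⊎ Tr n (powF r w) ≡ 1#
  Tr-pow∈𝔽₂ w = idempotent⇒0∨1 (Tr-idempotent n (powF r w) (frobenius-pow w))

  -- r^(m ∸ 1) = r⁻¹, so this is the coefficient of the character u ↦ r^u in u ↦ Tr(d^u).
  traceTransform : F → F
  traceTransform d = ∑[ u < m ] (powF (powF r (m ∸ 1)) (toℕ u) · Tr n (powF d (toℕ u)))

  traceTransform-pow : ∀ μ →
    traceTransform (powF r μ) ≡ ∑[ i < n ] geometricSum (powF r (m ∸ 1 ℕ.+ μ ℕ.* 2 ^ toℕ i)) m
  traceTransform-pow μ = begin
    ∑[ u < m ] (powF c (toℕ u) · Tr n (powF d (toℕ u)))
      ≡⟨ sum-cong-≗ {m} (λ u → cong (powF c (toℕ u) ·_) (sumF-map-upTo _ n)) ⟩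
    ∑[ u < m ] (powF c (toℕ u) · ∑[ i < n ] powF (powF d (toℕ u)) (2 ^ toℕ i))
      ≡⟨ sum-cong-≗ {m} (λ u → *-distribˡ-sum {n} (powF c (toℕ u)) _) ⟩
    ∑[ u < m ] ∑[ i < n ] (powF c (toℕ u) · powF (powF d (toℕ u)) (2 ^ toℕ i))
      ≡⟨ sum-cong-≗ {m} (λ u → sum-cong-≗ {n} (λ i → term (toℕ u) (toℕ i))) ⟩
    ∑[ u < m ] ∑[ i < n ] powF (powF r (m ∸ 1 ℕ.+ μ ℕ.* 2 ^ toℕ i)) (toℕ u)
      ≡⟨ ∑-comm {m} {n} (λ u i → powF (powF r (m ∸ 1 ℕ.+ μ ℕ.* 2 ^ toℕ i)) (toℕ u)) ⟩
    ∑[ i < n ] geometricSum (powF r (m ∸ 1 ℕ.+ μ ℕ.* 2 ^ toℕ i)) m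
      ∎
    where
    open ≡-Reasoning
    c d : F
    c = powF r (m ∸ 1)
    d = powF r μ
    term : ∀ u i → powF c u · powF (powF d u) (2 ^ i) ≡ powF (powF r (m ∸ 1 ℕ.+ μ ℕ.* 2 ^ i)) u
    term u i = begin
      powF c u · powF (powF d u) (2 ^ i)       ≡⟨ cong (powF c u ·_) (pow-* d (2 ^ i) u) ⟨
      powF c u · powF d (2 ^ i ℕ.* u)          ≡⟨ cong (λ k → powF c u · powF d k) (ℕ.*-comm (2 ^ i) u) ⟩
      powF c u · powF d (u ℕ.* 2 ^ i)          ≡⟨ cong (powF c u ·_) (pow-* d u (2 ^ i)) ⟩
      powF c u · powF (powF d (2 ^ i)) u       ≡⟨ pow-distrib-· c (powF d (2 ^ i)) u ⟨
      powF (c · powF d (2 ^ i)) u              ≡⟨ cong (λ y → powF (c · y) u) (pow-* r (2 ^ i) μ) ⟨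
      powF (c · powF r (2 ^ i ℕ.* μ)) u        ≡⟨ cong (λ k → powF (c · powF r k) u) (ℕ.*-comm (2 ^ i) μ) ⟩
      powF (c · powF r (μ ℕ.* 2 ^ i)) u        ≡⟨ cong (λ y → powF y u) (pow-+ r (m ∸ 1) (μ ℕ.* 2 ^ i)) ⟨
      powF (powF r (m ∸ 1 ℕ.+ μ ℕ.* 2 ^ i)) u  ∎

  traceTransform-r : traceTransform r ≡ 1#
  traceTransform-r = begin
    traceTransform r
      ≡⟨ cong traceTransform (*-identityʳ r) ⟨
    traceTransform (powF r 1)
      ≡⟨ traceTransform-pow 1 ⟩
    ∑[ i < n ] geometricSum (powF r (m ∸ 1 ℕ.+ 1 ℕ.* 2 ^ toℕ i)) m
      ≡⟨ ∑-single _ i₀ (λ i i≢i₀ → geometricSum-pow-∤ (m∤m∸1+2^i (toℕ≢0 i i≢i₀) (Fin.toℕ<n i))) ⟩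
    geometricSum (powF r (m ∸ 1 ℕ.+ 1 ℕ.* 2 ^ toℕ i₀)) m
      ≡⟨ geometricSum-pow-∣ (subst (m ℕ.∣_) m≡m∸1+2^0 ℕ.∣-refl) ⟩
    ∑[ i < m ] 1#
      ≡⟨ ∑-1#≡1 ⟩
    1#
      ∎
    where
    open ≡-Reasoning
    i₀ : Fin n
    i₀ = fromℕ< n>0
    toℕ≢0 : ∀ i → i ≢ i₀ → 0 < toℕ i
    toℕ≢0 i i≢i₀ = ℕ.n≢0⇒n>0 (λ i≡0 → i≢i₀ (Fin.toℕ-injective (trans i≡0 (sym (Fin.toℕ-fromℕ< n>0)))))
    m≡m∸1+2^0 : m ≡ m ∸ 1 ℕ.+ 1 ℕ.* 2 ^ toℕ i₀
    m≡m∸1+2^0 = trans (sym (ℕ.m∸n+n≡m (ℕ.>-nonZero⁻¹ m)))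
                      (cong (λ k → m ∸ 1 ℕ.+ 1 ℕ.* 2 ^ k) (sym (Fin.toℕ-fromℕ< n>0)))

  trace-invariant⇒ : ∀ μ → (∀ k → Tr n (powF (powF r μ) k) ≡ Tr n (powF r k)) →
                     ∃ λ j → m ℕ.∣ m ∸ 1 ℕ.+ μ ℕ.* 2 ^ j
  trace-invariant⇒ μ invariant with Fin.any? (λ i → m ℕ.∣? m ∸ 1 ℕ.+ μ ℕ.* 2 ^ toℕ i)
  ... | yes (i , m∣) = toℕ i , m∣
  ... | no  none     = ⊥-elim (0≢1 (begin
    0#                                              ≡⟨ sum-replicate-zero n ⟨
    ∑[ i < n ] 0#                                   ≡⟨ sum-cong-≗ {n} (λ i → geometricSum-pow-∤ (none ∘ (i ,_))) ⟨
    ∑[ i < n ] geometricSum (powF r (m ∸ 1 ℕ.+ μ ℕ.* 2 ^ toℕ i)) m  ≡⟨ traceTransform-pow μ ⟨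
    traceTransform (powF r μ)                       ≡⟨ sum-cong-≗ {m} (λ u → cong (powF (powF r (m ∸ 1)) (toℕ u) ·_) (invariant (toℕ u))) ⟩
    traceTransform r                                ≡⟨ traceTransform-r ⟩
    1#                                              ∎))
    where open ≡-Reasoning

  exponent : ℤ → F → ℤ
  exponent a u = ℤ.- (a * + ω u)

  exponent-cong : ∀ a {x w} → ω x ℕ.% m ≡ w ℕ.% m → exponent a x ℤ.%ℕ m ≡ (ℤ.- (a * + w)) ℤ.%ℕ m
  exponent-cong a {x} {w} ωx≡w = begin
    (ℤ.- (a * + ω x)) ℤ.%ℕ m      ≡⟨ cong (ℤ._%ℕ m) (ℤ.neg-distribˡ-* a (+ ω x)) ⟩
    (ℤ.- a * + ω x) ℤ.%ℕ m        ≡⟨ %ℕ-congˡ-* (ℤ.- a) ωx≡w ⟩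
    (ℤ.- a * + w) ℤ.%ℕ m          ≡⟨ cong (ℤ._%ℕ m) (ℤ.neg-distribˡ-* a (+ w)) ⟨
    (ℤ.- (a * + w)) ℤ.%ℕ m        ∎
    where open ≡-Reasoning

  exponent-injective : ∀ a → ¬ (+ m Signed.∣ a) → ∀ {x y} → x ≢ 0# → y ≢ 0# →
                       exponent a x ℤ.%ℕ m ≡ exponent a y ℤ.%ℕ m → x ≡ y
  exponent-injective a m∤a {x} {y} x≢0 y≢0 ex≡ey =
    Sum.[ ⊥-elim ∘ m∤a , m∣ωy-ωx⇒x≡y ] (∣*⇒∣⊎∣ a (+ ω y - + ω x) m∣a[ωy-ωx])
    where
    m∣a[ωy-ωx] : + m Signed.∣ a * (+ ω y - + ω x)
    m∣a[ωy-ωx] = subst (+ m Signed.∣_) (-[ap]+aq≡a[q-p] a (+ ω x) (+ ω y)) (%ℕ≡⇒∣- (exponent a x) (exponent a y) ex≡ey)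
    m∣ωy-ωx⇒x≡y : + m Signed.∣ + ω y - + ω x → x ≡ y
    m∣ωy-ωx⇒x≡y m∣ωy-ωx = begin
      x               ≡⟨ teichmüller x x≢0 ⟨
      powF r (ω x)    ≡⟨ pow-cong (sym (∣-⇒%ℕ≡ (+ ω y) (+ ω x) m∣ωy-ωx)) ⟩
      powF r (ω y)    ≡⟨ teichmüller y y≢0 ⟩
      y               ∎
      where open ≡-Reasoning

  S-coefficient : ∀ a → ¬ (+ m Signed.∣ a) → ∀ {x} → x ≢ 0# → ∀ i → toℕ i ≡ exponent a x ℤ.%ℕ m →
                  S (ωNeg ω a) i ≡ ψ (Tr n x)
  S-coefficient a m∤a {x} x≢0 i i≡ex = begin
    S (ωNeg ω a) i                                                ≡⟨ ⊕-foldr-coefficient _ units i ⟩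
    sumℤ (map (λ y → ψ (Tr n y) * ζ^ (exponent a y) i) units)     ≡⟨ sumℤ-map-single units units-unique (∈-units x≢0) off ⟩
    ψ (Tr n x) * ζ^ (exponent a x) i                              ≡⟨ cong (ψ (Tr n x) *_) (ζ^-at _ i i≡ex) ⟩
    ψ (Tr n x) * + 1                                              ≡⟨ ℤ.*-identityʳ _ ⟩
    ψ (Tr n x)                                                    ∎
    where
    open ≡-Reasoning
    off : ∀ {y} → y ∈ units → y ≢ x → ψ (Tr n y) * ζ^ (exponent a y) i ≡ + 0
    off {y} y∈units y≢x = trans (cong (ψ (Tr n y) *_) (ζ^-off _ i i≢ey)) (ℤ.*-zeroʳ (ψ (Tr n y)))
      where
      i≢ey : toℕ i ≢ exponent a y ℤ.%ℕ m
      i≢ey i≡ey = y≢x (exponent-injective a m∤a (∈-units⁻ y∈units) x≢0 (trans (sym i≡ey) i≡ex))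

  -- For m ∣ a the character ω^(-a) is trivial and factors through the norm to 𝔽₂.
  regular⇒∤ : ∀ a → Regular (ωNeg ω a) → ¬ (+ m Signed.∣ a)
  regular⇒∤ a regular m∣a = regular (1 , n , sym (ℕ.*-identityˡ n) , 2^n∸1-prime⇒1<n n m-prime ,
                                     (λ _ → ζ^ (+ 0)) , λ x _ → 0ζ , trivial x)
    where
    trivial : ∀ x i → ωNeg ω a x i - ζ^ (+ 0) i ≡ (Φ ⊛ 0ζ) i
    trivial x i = begin
      ζ^ (exponent a x) i - ζ^ (+ 0) i   ≡⟨ cong (_- ζ^ (+ 0) i) (ζ^-cong ex≡0 i) ⟩
      ζ^ (+ 0) i - ζ^ (+ 0) i            ≡⟨ ℤ.+-inverseʳ (ζ^ (+ 0) i) ⟩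
      + 0                                ≡⟨ sumℤ-map-zero {f = 0ζ} (allFin m) (λ _ → refl) ⟨
      sumℤ (map 0ζ (allFin m))           ≡⟨ Φ⊛-constant 0ζ i ⟨
      (Φ ⊛ 0ζ) i                         ∎
      where
      open ≡-Reasoning
      ex≡0 : exponent a x ℤ.%ℕ m ≡ (+ 0) ℤ.%ℕ m
      ex≡0 = ∣-⇒%ℕ≡ (exponent a x) (+ 0)
               (subst (+ m Signed.∣_) (sym (ℤ.+-identityʳ _)) (Signed.∣m⇒∣-m (Signed.∣m⇒∣m*n (+ ω x) m∣a)))

  Tr-unit∈𝔽₂ : ∀ {x} → x ≢ 0# → Tr n x ≡ 0# ⊎ Tr n x ≡ 1#
  Tr-unit∈𝔽₂ {x} x≢0 = subst (λ y → Tr n y ≡ 0# ⊎ Tr n y ≡ 1#) (teichmüller x x≢0) (Tr-pow∈𝔽₂ (ω x))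

  S≈⇒trace-invariant : ∀ α β μ → ¬ (+ m Signed.∣ α) → ¬ (+ m Signed.∣ β) → (α * + μ) ℤ.%ℕ m ≡ β ℤ.%ℕ m →
                       S (ωNeg ω α) ≈ S (ωNeg ω β) → ∀ k → Tr n (powF (powF r μ) k) ≡ Tr n (powF r k)
  S≈⇒trace-invariant α β μ m∤α m∤β αμ≡β (t , S-difference) k =
    ψ-injective-on-𝔽₂ (Tr-unit∈𝔽₂ (xₖ≢0 k)) (Tr-unit∈𝔽₂ (pow-r≢0 k))
      (ℤ.i-j≡0⇒i≡j _ _ (trans (ψ-difference k) c≡0))
    where
    xₖ≢0 : ∀ k → powF (powF r μ) k ≢ 0#
    xₖ≢0 k = subst (_≢ 0#) (pow-* r k μ) (pow-r≢0 (k ℕ.* μ))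

    exponents-match : ∀ k → exponent α (powF (powF r μ) k) ℤ.%ℕ m ≡ exponent β (powF r k) ℤ.%ℕ m
    exponents-match k = begin
      exponent α (powF (powF r μ) k) ℤ.%ℕ m   ≡⟨ exponent-cong α ωxₖ≡kμ ⟩
      (ℤ.- (α * + (k ℕ.* μ))) ℤ.%ℕ m          ≡⟨ cong (ℤ._%ℕ m) (trans (cong (λ z → ℤ.- (α * z)) (ℤ.pos-* k μ)) (-[a[kμ]]≡-k[aμ] α (+ k) (+ μ))) ⟩
      (ℤ.- + k * (α * + μ)) ℤ.%ℕ m            ≡⟨ %ℕ-congˡ-* (ℤ.- + k) αμ≡β ⟩
      (ℤ.- + k * β) ℤ.%ℕ m                    ≡⟨ cong (ℤ._%ℕ m) (-k*b≡-[bk] (+ k) β) ⟩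
      (ℤ.- (β * + k)) ℤ.%ℕ m                  ≡⟨ exponent-cong β (ω-pow k) ⟨
      exponent β (powF r k) ℤ.%ℕ m            ∎
      where
      open ≡-Reasoning
      ωxₖ≡kμ : ω (powF (powF r μ) k) ℕ.% m ≡ (k ℕ.* μ) ℕ.% m
      ωxₖ≡kμ = trans (cong (λ y → ω y ℕ.% m) (sym (pow-* r k μ))) (ω-pow (k ℕ.* μ))

    ψ-difference : ∀ k → ψ (Tr n (powF (powF r μ) k)) - ψ (Tr n (powF r k)) ≡ sumℤ (map t (allFin m))
    ψ-difference k = begin
      ψ (Tr n (powF (powF r μ) k)) - ψ (Tr n (powF r k))
        ≡⟨ cong₂ _-_ (S-coefficient α m∤α (xₖ≢0 k) I I≡) (S-coefficient β m∤β (pow-r≢0 k) I (trans I≡ (exponents-match k))) ⟨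
      S (ωNeg ω α) I - S (ωNeg ω β) I
        ≡⟨ S-difference I ⟩
      (Φ ⊛ t) I
        ≡⟨ Φ⊛-constant t I ⟩
      sumℤ (map t (allFin m))
        ∎
      where
      open ≡-Reasoning
      I : Fin m
      I = fromℕ< (n%ℕd<d (exponent α (powF (powF r μ) k)) m)
      I≡ : toℕ I ≡ exponent α (powF (powF r μ) k) ℤ.%ℕ m
      I≡ = Fin.toℕ-fromℕ< _

    -- At k = 0 both units are 1#.
    c≡0 : sumℤ (map t (allFin m)) ≡ + 0
    c≡0 = trans (sym (ψ-difference 0)) (ℤ.+-inverseʳ (ψ (Tr n 1#)))

proposition4p17 : (n : ℕ) → 0 < n → (pr : Prime (2 ^ n ∸ 1)) →
    (𝔽 : FiniteField (2 ^ n)) →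
    (r : FiniteField.F 𝔽) →
    Setting.IsReductionRoot n {{prime⇒nonZero pr}} 𝔽 r →
    (ω : FiniteField.F 𝔽 → ℕ) →
    Setting.IsTeichmuller n {{prime⇒nonZero pr}} 𝔽 r ω →
    (α β : ℤ) →
    Setting.Regular n {{prime⇒nonZero pr}} 𝔽 (Setting.ωNeg n {{prime⇒nonZero pr}} 𝔽 ω α) →
    Setting.Regular n {{prime⇒nonZero pr}} 𝔽 (Setting.ωNeg n {{prime⇒nonZero pr}} 𝔽 ω β) →
    Cyclo._≈_ (2 ^ n ∸ 1) {{prime⇒nonZero pr}}
      (Setting.S n {{prime⇒nonZero pr}} 𝔽 (Setting.ωNeg n {{prime⇒nonZero pr}} 𝔽 ω α))
      (Setting.S n {{prime⇒nonZero pr}} 𝔽 (Setting.ωNeg n {{prime⇒nonZero pr}} 𝔽 ω β)) →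
    ∃ λ (j : ℕ) → (+ (2 ^ n ∸ 1)) ∣ (α - (+ (2 ^ j)) * β)
proposition4p17 n n>0 pr 𝔽 r root ω teichmüller α β regular-α regular-β S-α≈S-β =
  j , Signed.∣⇒∣ᵤ (%ℕ≡⇒∣- α (+ (2 ^ j) * β) α≡2^jβ)
  where
  open TeichmüllerSetting n n>0 pr 𝔽 r root ω teichmüller
  open Residues m
  open FieldOps 𝔽 using (powF; Tr)
  m∤α : ¬ (+ m Signed.∣ α)
  m∤α = regular⇒∤ α regular-α
  m∤β : ¬ (+ m Signed.∣ β)
  m∤β = regular⇒∤ β regular-β
  μ : ℕ
  μ = proj₁ (%ℕ-linear-solution α β m∤α)
  αμ≡β : (α * + μ) ℤ.%ℕ m ≡ β ℤ.%ℕ m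
  αμ≡β = proj₂ (%ℕ-linear-solution α β m∤α)
  trace-invariant : ∀ k → Tr n (powF (powF r μ) k) ≡ Tr n (powF r k)
  trace-invariant = S≈⇒trace-invariant α β μ m∤α m∤β αμ≡β S-α≈S-β
  j : ℕ
  j = proj₁ (trace-invariant⇒ μ trace-invariant)
  m∣m∸1+μ2^j : m ℕ.∣ m ∸ 1 ℕ.+ μ ℕ.* 2 ^ j
  m∣m∸1+μ2^j = proj₂ (trace-invariant⇒ μ trace-invariant)
  α≡2^jβ : α ℤ.%ℕ m ≡ (+ (2 ^ j) * β) ℤ.%ℕ m
  α≡2^jβ = aμ≡b∧μc≡1⇒a≡cb {α} {β} {μ} {2 ^ j} αμ≡β (∣m∸1+x⇒x%m≡1%m m∣m∸1+μ2^j)
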